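{- Let $G$ be a clustered graph on $mn$ vertices with $n$ clusters $C_i=\{v_{i,1},\dots,v_{i,m}\}$, $i=1,\dots,n$, and let $G_a$ be its alternating clustered graph. Then $G^\tau$ and $G_a^\tau$ are isomorphic. Moreover, if $G$ and $G^\tau$ are cospectral, then $G_a$ and $G_a^\tau$ are cospectral.
   Context: All graphs are finite, simple and undirected. A clustered graph is a graph whose labelled vertex set is partitioned into clusters of equal size, each cluster being an ordered list of vertices. For a clustered graph with clusters $C_i=\{v_{i,1},\dots,v_{i,m}\}$ ($v_{i,k}$ being the $k$-th vertex of the $i$-th cluster), its graph theoretical partial transpose is the graph on the same vertex set obtained by keeping every edge inside a cluster and every edge joining the $k$-th vertices of two different clusters, and replacing every edge joining the $k$-th vertex of cluster $i$ with the $l$-th vertex of cluster $j$, where $i\neq j$ and $k\neq l$, by the edge joining the $l$-th vertex of cluster $i$ with the $k$-th vertex of cluster $j$. The alternating clustered graph $G_a$ of $G$ is the same graph (same vertices and edges) with the alternative clustering into $m$ clusters $C'_j=\{v_{1,j},v_{2,j},\dots,v_{n,j}\}$, $j=1,\dots,m$, where $v_{i,j}$ is the $i$-th vertex of $C'_j$; $G_a^\tau$ is its partial transpose with respect to this clustering. Cospectral means equal multisets of adjacency eigenvalues. -}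

module Defs where

open import Data.Bool using (Bool; true; false; if_then_else_)
open import Data.Nat using (ℕ; zero; suc)
open import Data.Fin as Fin using (Fin; zero; suc; punchIn; remQuot)
open import Data.Product using (Σ; _×_; _,_)
open import Data.Integer using (ℤ; +_; -_; _+_; _-_; _*_)
open import Relation.Binary.PropositionalEquality using (_≡_; refl; sym)
open import Relation.Nullary using (yes; no)
open import Relation.Nullary.Decidable using (⌊_⌋)
open import Data.Empty using (⊥-elim)
open import Function.Bundles using (_↔_; Inverse)

record Graph (V : Set) : Set where
  field
    adj        : V → V → Bool
    adj-sym    : ∀ u v → adj u v ≡ adj v u
    adj-irrefl : ∀ v → adj v v ≡ false
open Graph public

-- A clustered graph with n clusters of size m: vertex (i , k) is v_{i,k},
-- the k-th vertex of the i-th cluster.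
ClusteredGraph : ℕ → ℕ → Set
ClusteredGraph n m = Graph (Fin n × Fin m)

τadj : ∀ {n m} → ClusteredGraph n m → Fin n × Fin m → Fin n × Fin m → Bool
τadj G (i , a) (j , b) with i Fin.≟ j
... | yes _ = adj G (i , a) (j , b)
... | no  _ = adj G (i , b) (j , a)

τsym : ∀ {n m} (G : ClusteredGraph n m) u v → τadj G u v ≡ τadj G v u
τsym G (i , a) (j , b) with i Fin.≟ j | j Fin.≟ i
... | yes _ | yes _ = adj-sym G (i , a) (j , b)
... | yes p | no ¬q = ⊥-elim (¬q (sym p))
... | no ¬p | yes q = ⊥-elim (¬p (sym q))
... | no _  | no _  = adj-sym G (i , b) (j , a)

τirrefl : ∀ {n m} (G : ClusteredGraph n m) v → τadj G v v ≡ false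
τirrefl G (i , a) with i Fin.≟ i
... | yes _ = adj-irrefl G (i , a)
... | no ¬p = ⊥-elim (¬p refl)

partialTranspose : ∀ {n m} → ClusteredGraph n m → ClusteredGraph n m
partialTranspose G = record
  { adj = τadj G ; adj-sym = τsym G ; adj-irrefl = τirrefl G }

-- The alternating clustered graph G_a: same graph, m clusters of size n,
-- vertex v_{i,j} of G is the i-th vertex of the j-th cluster C'_j.
alternating : ∀ {n m} → ClusteredGraph n m → ClusteredGraph m n
alternating G = record
  { adj        = λ { (j , i) (j' , i') → adj G (i , j) (i' , j') }
  ; adj-sym    = λ { (j , i) (j' , i') → adj-sym G (i , j) (i' , j') }
  ; adj-irrefl = λ { (j , i) → adj-irrefl G (i , j) }
  }

Isomorphic : ∀ {V W : Set} → Graph V → Graph W → Set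
Isomorphic {V} {W} G H =
  Σ (V ↔ W) λ f → ∀ u v → adj H (Inverse.to f u) (Inverse.to f v) ≡ adj G u v

sumℤ : ∀ n → (Fin n → ℤ) → ℤ
sumℤ zero    f = + 0
sumℤ (suc n) f = f zero + sumℤ n (λ i → f (suc i))

sign : ℕ → ℤ
sign zero          = + 1
sign (suc zero)    = - (+ 1)
sign (suc (suc k)) = sign k

det : ∀ n → (Fin n → Fin n → ℤ) → ℤ
det zero    M = + 1
det (suc n) M = sumℤ (suc n) λ j →
  sign (Fin.toℕ j) * M zero j * det n (λ r c → M (suc r) (punchIn j c))

-- Adjacency matrix of a clustered graph, vertices ordered lexicographically
-- (any ordering gives the same characteristic polynomial).
adjMatrix : ∀ {n m} → ClusteredGraph n m →
            Fin (n Data.Nat.* m) → Fin (n Data.Nat.* m) → ℤ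
adjMatrix {n} {m} G k l =
  if adj G (remQuot m k) (remQuot m l) then + 1 else + 0

charPolyAt : ∀ {n m} → ClusteredGraph n m → ℤ → ℤ
charPolyAt {n} {m} G t = det (n Data.Nat.* m) λ k l →
  (if ⌊ k Fin.≟ l ⌋ then t else + 0) - adjMatrix G k l

-- Cospectral: same characteristic polynomial (equivalently, the same
-- multiset of adjacency eigenvalues, the adjacency matrix being real symmetric).
Cospectral : ∀ {n m} → ClusteredGraph n m → ClusteredGraph n m → Set
Cospectral G H = ∀ t → charPolyAt G t ≡ charPolyAt H t

{-# OPTIONS --safe #-}

-- Swapping coordinates, v_{i,k} ↦ v_{k,i}, is an isomorphism G ≅ G_a by definition, and also
-- G^τ ≅ G_a^τ: both partial transposes turn an edge v_{i,k} v_{j,l} with i ≠ j and k ≠ l into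
-- v_{i,l} v_{j,k} and keep every other edge. Isomorphic graphs have adjacency matrices conjugate
-- by a permutation matrix, hence equal characteristic polynomials, so G_a, G, G^τ and G_a^τ all
-- share one as soon as G and G^τ do. Invariance of the Laplace-expansion
-- determinant under a simultaneous permutation of rows and columns is proved by writing the
-- permutation as a product of adjacent transpositions, each of which negates the determinant once
-- as a row swap and once as a column swap.

module Submission where

open import Defs
open import Algebra.Properties.CommutativeSemigroup using (x∙yz≈y∙xz)
open import Data.Bool using (if_then_else_)
open import Data.Fin as Fin using (Fin; zero; suc; toℕ; punchIn; punchOut)
open import Data.Fin.Permutation using (↔⇒≡)
open import Data.Fin.Properties
  using ( 0≢1+n; suc-injective; punchInᵢ≢i; punchIn-punchOut; punchOut-cong; punchOut-punchIn
        ; punchOut-injective; *↔×)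
open import Data.Integer
  using (ℤ; -_; _+_; _-_; _*_; 0ℤ; 1ℤ; -1ℤ)
open import Data.Integer.Properties
  using ( +-*-semiring; +-commutativeSemigroup; +-identityˡ; *-identityˡ; *-identityʳ
        ; neg-involutive; -1*i≡-i)
open import Data.Integer.Tactic.RingSolver using (solve; solve-∀)
open import Data.List using (_∷_; [])
open import Data.Nat as ℕ using (ℕ; zero; suc)
open import Data.Product using (_×_; _,_; swap)
open import Data.Product.Algebra using (×-comm)
open import Function using (_∘_; _↔_; Inverse; Injection; mk⇔)
open import Function.Construct.Composition using (_↔-∘_)
open import Function.Construct.Symmetry using (↔-sym)
open import Function.Definitions using (Injective)
open import Function.Properties.Inverse using (↔⇒↣)
open import Relation.Binary.PropositionalEquality
open import Relation.Nullary using (Dec; yes; no; does; contradiction)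
open import Relation.Nullary.Decidable using (⌊_⌋; isYes≗does; does-⇔)
open import Algebra.Properties.Semiring.Sum +-*-semiring
  using (sum; sum-cong-≗; *-distribˡ-sum; ∑-comm; sum-remove)

open ≡-Reasoning

sumℤ≡sum : ∀ n (f : Fin n → ℤ) → sumℤ n f ≡ sum f
sumℤ≡sum zero    f = refl
sumℤ≡sum (suc n) f = cong (f zero +_) (sumℤ≡sum n (f ∘ suc))

sumℤ-cong : ∀ n {f g : Fin n → ℤ} → f ≗ g → sumℤ n f ≡ sumℤ n g
sumℤ-cong n {f} {g} f≗g = begin
  sumℤ n f  ≡⟨ sumℤ≡sum n f ⟩
  sum f     ≡⟨ sum-cong-≗ f≗g ⟩
  sum g     ≡⟨ sumℤ≡sum n g ⟨
  sumℤ n g  ∎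

*-distribˡ-sumℤ : ∀ n x (f : Fin n → ℤ) → x * sumℤ n f ≡ sumℤ n (λ i → x * f i)
*-distribˡ-sumℤ n x f = begin
  x * sumℤ n f            ≡⟨ cong (x *_) (sumℤ≡sum n f) ⟩
  x * sum f               ≡⟨ *-distribˡ-sum x f ⟩
  sum (λ i → x * f i)     ≡⟨ sumℤ≡sum n _ ⟨
  sumℤ n (λ i → x * f i)  ∎

neg-distrib-sumℤ : ∀ n (f : Fin n → ℤ) → - sumℤ n f ≡ sumℤ n (λ i → - f i)
neg-distrib-sumℤ n f = begin
  - sumℤ n f                ≡⟨ -1*i≡-i _ ⟨
  -1ℤ * sumℤ n f            ≡⟨ *-distribˡ-sumℤ n -1ℤ f ⟩
  sumℤ n (λ i → -1ℤ * f i)  ≡⟨ sumℤ-cong n (-1*i≡-i ∘ f) ⟩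
  sumℤ n (λ i → - f i)      ∎

sumℤ-comm : ∀ m n (f : Fin m → Fin n → ℤ) →
            sumℤ m (λ i → sumℤ n (f i)) ≡ sumℤ n (λ j → sumℤ m (λ i → f i j))
sumℤ-comm m n f = begin
  sumℤ m (λ i → sumℤ n (f i))          ≡⟨ sumℤ-cong m (λ i → sumℤ≡sum n (f i)) ⟩
  sumℤ m (λ i → sum (f i))             ≡⟨ sumℤ≡sum m _ ⟩
  sum (λ i → sum (f i))                ≡⟨ ∑-comm f ⟩
  sum (λ j → sum (λ i → f i j))        ≡⟨ sumℤ≡sum n _ ⟨
  sumℤ n (λ j → sum (λ i → f i j))     ≡⟨ sumℤ-cong n (λ j → sumℤ≡sum m _) ⟨
  sumℤ n (λ j → sumℤ m (λ i → f i j))  ∎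

sumℤ-remove : ∀ n (a : Fin (suc n)) (f : Fin (suc n) → ℤ) →
              sumℤ (suc n) f ≡ f a + sumℤ n (f ∘ punchIn a)
sumℤ-remove n a f = begin
  sumℤ (suc n) f                ≡⟨ sumℤ≡sum (suc n) f ⟩
  sum f                         ≡⟨ sum-remove f ⟩
  f a + sum (f ∘ punchIn a)     ≡⟨ cong (f a +_) (sumℤ≡sum n _) ⟨
  f a + sumℤ n (f ∘ punchIn a)  ∎

swapAt : ∀ {n} → Fin n → Fin (suc n) → Fin (suc n)
swapAt zero    zero          = suc zero
swapAt zero    (suc zero)    = zero
swapAt zero    (suc (suc i)) = suc (suc i)
swapAt (suc c) zero          = zero
swapAt (suc c) (suc i)       = suc (swapAt c i)

sumℤ-swapAt : ∀ n (c : Fin n) (f : Fin (suc n) → ℤ) →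
              sumℤ (suc n) (f ∘ swapAt c) ≡ sumℤ (suc n) f
sumℤ-swapAt (suc n) zero    f = x∙yz≈y∙xz +-commutativeSemigroup (f (suc zero)) (f zero) _
sumℤ-swapAt (suc n) (suc c) f = cong (f zero +_) (sumℤ-swapAt n c (f ∘ suc))

private
  neg-*-neg : ∀ x y → - x * - y ≡ x * y
  neg-*-neg = solve-∀

  neg-*-*ˡ : ∀ x y z → - x * y * z ≡ - (x * y * z)
  neg-*-*ˡ = solve-∀

  neg-*-*ʳ : ∀ x y z → x * y * - z ≡ - (x * y * z)
  neg-*-*ʳ = solve-∀

  exchange-factors : ∀ s t s′ t′ x y d → s′ * t′ ≡ - (s * t) →
                     s′ * y * (t′ * x * d) ≡ - (s * x * (t * y * d))
  exchange-factors s t s′ t′ x y d s′t′≡-st = begin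
    s′ * y * (t′ * x * d)    ≡⟨ solve (s′ ∷ t′ ∷ x ∷ y ∷ d ∷ []) ⟩
    s′ * t′ * (x * y * d)    ≡⟨ cong (_* (x * y * d)) s′t′≡-st ⟩
    - (s * t) * (x * y * d)  ≡⟨ solve (s ∷ t ∷ x ∷ y ∷ d ∷ []) ⟩
    - (s * x * (t * y * d))  ∎

Matrix : ℕ → Set
Matrix n = Fin n → Fin n → ℤ

reindex : ∀ {m n} → (Fin m → Fin n) → Matrix n → Matrix m
reindex σ M r c = M (σ r) (σ c)

sgn : ∀ {n} → Fin n → ℤ
sgn j = sign (toℕ j)

sgn-suc : ∀ {n} (j : Fin n) → sgn (suc j) ≡ - sgn j
sgn-suc j = sign-suc (toℕ j)
  where
  sign-suc : ∀ k → sign (suc k) ≡ - sign k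
  sign-suc zero    = refl
  sign-suc (suc k) = trans (sym (neg-involutive (sign k))) (cong -_ (sym (sign-suc k)))

sgn-suc-* : ∀ {m n} (i : Fin m) (j : Fin n) → sgn (suc i) * sgn (suc j) ≡ sgn i * sgn j
sgn-suc-* i j = trans (cong₂ _*_ (sgn-suc i) (sgn-suc j)) (neg-*-neg (sgn i) (sgn j))

minor : ∀ {n} → Matrix (suc n) → Fin (suc n) → Matrix n
minor M j r c = M (suc r) (punchIn j c)

laplaceTerm : ∀ {n} → Matrix (suc n) → Fin (suc n) → ℤ
laplaceTerm {n} M j = sgn j * M zero j * det n (minor M j)

det-cong : ∀ n {M N : Matrix n} → (∀ r c → M r c ≡ N r c) → det n M ≡ det n N
det-cong zero    M≡N = refl
det-cong (suc n) M≡N = sumℤ-cong (suc n) λ j →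
  cong₂ (λ x d → sgn j * x * d) (M≡N zero j) (det-cong n λ r c → M≡N (suc r) (punchIn j c))

-- Deleting column j commutes with swapping columns c and c + 1, up to sign if j is one of them and
-- up to an adjacent swap inside the minor otherwise.
data SwapAtMinor {n} (c : Fin (suc n)) (j : Fin (suc (suc n))) : Set where
  moved : sgn j ≡ - sgn (swapAt c j) →
          (∀ k → swapAt c (punchIn j k) ≡ punchIn (swapAt c j) k) → SwapAtMinor c j
  fixed : swapAt c j ≡ j → (c′ : Fin n) →
          (∀ k → swapAt c (punchIn j k) ≡ punchIn j (swapAt c′ k)) → SwapAtMinor c j

swapAtMinor : ∀ {n} (c : Fin (suc n)) j → SwapAtMinor c j
swapAtMinor zero zero                   = moved refl λ { zero → refl ; (suc k) → refl }
swapAtMinor zero (suc zero)             = moved refl λ { zero → refl ; (suc k) → refl }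
swapAtMinor {suc n} zero (suc (suc j))  =
  fixed refl zero λ { zero → refl ; (suc zero) → refl ; (suc (suc k)) → refl }
swapAtMinor {suc n} (suc c) zero        = fixed refl c λ k → refl
swapAtMinor {suc n} (suc c) (suc j) with swapAtMinor c j
... | moved sgn-j punchIn-j = moved
  (trans (sgn-suc j) (trans (cong -_ sgn-j) (cong -_ (sym (sgn-suc (swapAt c j))))))
  λ { zero → refl ; (suc k) → cong suc (punchIn-j k) }
... | fixed j-fixed c′ punchIn-j = fixed (cong suc j-fixed) (suc c′)
  λ { zero → refl ; (suc k) → cong suc (punchIn-j k) }

det-swapColumns : ∀ n (c : Fin n) (M : Matrix (suc n)) →
                  det (suc n) (λ r → M r ∘ swapAt c) ≡ - det (suc n) M
det-swapColumns (suc n) c M = begin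
  det (suc (suc n)) M′
    ≡⟨ sumℤ-cong _ term-swap ⟩
  sumℤ (suc (suc n)) (λ j → - laplaceTerm M (swapAt c j))
    ≡⟨ neg-distrib-sumℤ _ (laplaceTerm M ∘ swapAt c) ⟨
  - sumℤ (suc (suc n)) (laplaceTerm M ∘ swapAt c)
    ≡⟨ cong -_ (sumℤ-swapAt _ c (laplaceTerm M)) ⟩
  - det (suc (suc n)) M                                     ∎
  where
  M′ : Matrix (suc (suc n))
  M′ r = M r ∘ swapAt c

  term-swap : ∀ j → laplaceTerm M′ j ≡ - laplaceTerm M (swapAt c j)
  term-swap j with swapAtMinor c j
  ... | moved sgn-j punchIn-j = begin
    sgn j * M zero j′ * det (suc n) (minor M′ j)
      ≡⟨ cong₂ (λ s d → s * M zero j′ * d) sgn-j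
               (det-cong (suc n) λ r k → cong (M (suc r)) (punchIn-j k)) ⟩
    - sgn j′ * M zero j′ * det (suc n) (minor M j′)
      ≡⟨ neg-*-*ˡ (sgn j′) (M zero j′) (det (suc n) (minor M j′)) ⟩
    - laplaceTerm M j′                               ∎
    where
    j′ : Fin (suc (suc n))
    j′ = swapAt c j
  ... | fixed j-fixed c′ punchIn-j = begin
    sgn j * M zero j′ * det (suc n) (minor M′ j)
      ≡⟨ cong (sgn j * M zero j′ *_) (det-cong (suc n) λ r k → cong (M (suc r)) (punchIn-j k)) ⟩
    sgn j * M zero j′ * det (suc n) (λ r → minor M j r ∘ swapAt c′)
      ≡⟨ cong (sgn j * M zero j′ *_) (det-swapColumns n c′ (minor M j)) ⟩
    sgn j * M zero j′ * - det (suc n) (minor M j)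
      ≡⟨ neg-*-*ʳ (sgn j) (M zero j′) (det (suc n) (minor M j)) ⟩
    - (sgn j * M zero j′ * det (suc n) (minor M j))
      ≡⟨ cong (λ i → - (sgn i * M zero j′ * det (suc n) (minor M i))) j-fixed ⟨
    - laplaceTerm M j′                               ∎
    where
    j′ : Fin (suc (suc n))
    j′ = swapAt c j

record ColumnPairDeletion {n} (a b : Fin (suc (suc n))) : Set where
  field
    k k′          : Fin (suc n)
    punchIn-a-k   : punchIn a k ≡ b
    punchIn-b-k′  : punchIn b k′ ≡ a
    sgn-antisym   : sgn b * sgn k′ ≡ - (sgn a * sgn k)
    punchIn-comm  : ∀ c → punchIn a (punchIn k c) ≡ punchIn b (punchIn k′ c)

columnPairDeletion : ∀ {n} {a b : Fin (suc (suc n))} → a ≢ b → ColumnPairDeletion a b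
columnPairDeletion {a = zero} {zero} a≢b = contradiction refl a≢b
columnPairDeletion {a = zero} {suc b} _ = record
  { k = b ; k′ = zero ; punchIn-a-k = refl ; punchIn-b-k′ = refl
  ; sgn-antisym  = trans (*-identityʳ _) (trans (sgn-suc b) (cong -_ (sym (*-identityˡ _))))
  ; punchIn-comm = λ c → refl
  }
columnPairDeletion {a = suc a} {zero} _ = record
  { k = zero ; k′ = a ; punchIn-a-k = refl ; punchIn-b-k′ = refl
  ; sgn-antisym  = trans (*-identityˡ _)
      (trans (sym (neg-involutive _)) (cong -_ (trans (sym (sgn-suc a)) (sym (*-identityʳ _)))))
  ; punchIn-comm = λ c → refl
  }
columnPairDeletion {zero} {a = suc zero} {suc zero} a≢b = contradiction refl a≢b
columnPairDeletion {suc n} {a = suc a} {suc b} a≢b = record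
  { k = suc k ; k′ = suc k′
  ; punchIn-a-k  = cong suc punchIn-a-k
  ; punchIn-b-k′ = cong suc punchIn-b-k′
  ; sgn-antisym  = trans (sgn-suc-* b k′) (trans sgn-antisym (cong -_ (sym (sgn-suc-* a k))))
  ; punchIn-comm = λ { zero → refl ; (suc c) → cong suc (punchIn-comm c) }
  }
  where open ColumnPairDeletion (columnPairDeletion (a≢b ∘ cong suc))

module _ {n : ℕ} where

  twoRowTerm : Matrix (suc (suc n)) → Fin (suc (suc n)) → Fin (suc n) → ℤ
  twoRowTerm M a k = sgn a * M zero a * laplaceTerm (minor M a) k

  -- Expanding along rows 0 and 1 at once: the term where row 0 uses column a and row 1 column b.
  -- Swapping the two rows exchanges a and b and flips the sign of the term.
  columnPairTerm : Matrix (suc (suc n)) → Fin (suc (suc n)) → Fin (suc (suc n)) → ℤ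
  columnPairTerm M a b with a Fin.≟ b
  ... | yes _   = 0ℤ
  ... | no a≢b  = twoRowTerm M a (punchOut a≢b)

  columnPairTerm-diag : ∀ M a → columnPairTerm M a a ≡ 0ℤ
  columnPairTerm-diag M a with a Fin.≟ a
  ... | yes _   = refl
  ... | no a≢a  = contradiction refl a≢a

  columnPairTerm-punchIn : ∀ M {a b k} → punchIn a k ≡ b → columnPairTerm M a b ≡ twoRowTerm M a k
  columnPairTerm-punchIn M {a} {b} {k} refl with a Fin.≟ punchIn a k
  ... | yes a≡b  = contradiction (sym a≡b) (punchInᵢ≢i a k)
  ... | no a≢b   = cong (twoRowTerm M a) (trans (punchOut-cong a refl) (punchOut-punchIn a))

  det-columnPairs : ∀ M → det (suc (suc n)) M ≡
                    sumℤ (suc (suc n)) (λ a → sumℤ (suc (suc n)) (columnPairTerm M a))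
  det-columnPairs M = sumℤ-cong (suc (suc n)) λ a → begin
    sgn a * M zero a * det (suc n) (minor M a)
      ≡⟨ *-distribˡ-sumℤ (suc n) (sgn a * M zero a) (laplaceTerm (minor M a)) ⟩
    sumℤ (suc n) (twoRowTerm M a)                  ≡⟨ +-identityˡ _ ⟨
    0ℤ + sumℤ (suc n) (twoRowTerm M a)
      ≡⟨ cong₂ _+_ (columnPairTerm-diag M a)
                   (sumℤ-cong (suc n) λ k → columnPairTerm-punchIn M {a} {punchIn a k} {k} refl) ⟨
    columnPairTerm M a a + sumℤ (suc n) (columnPairTerm M a ∘ punchIn a)
      ≡⟨ sumℤ-remove (suc n) a (columnPairTerm M a) ⟨
    sumℤ (suc (suc n)) (columnPairTerm M a)        ∎

  columnPairTerm-swapRows : ∀ M a b → columnPairTerm (M ∘ swapAt zero) b a ≡ - columnPairTerm M a b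
  columnPairTerm-swapRows M a b = cases (a Fin.≟ b)
    where
    cases : Dec (a ≡ b) → columnPairTerm (M ∘ swapAt zero) b a ≡ - columnPairTerm M a b
    cases (yes refl) = trans (columnPairTerm-diag _ a) (sym (cong -_ (columnPairTerm-diag M a)))
    cases (no a≢b) = begin
      columnPairTerm (M ∘ swapAt zero) b a                 ≡⟨ columnPairTerm-punchIn _ punchIn-b-k′ ⟩
      twoRowTerm (M ∘ swapAt zero) b k′
        ≡⟨ cong₂ (λ x d → sgn b * M (suc zero) b * (sgn k′ * M zero x * d)) punchIn-b-k′
                 (det-cong n λ r c → cong (M (suc (suc r))) (sym (punchIn-comm c))) ⟩
      sgn b * M (suc zero) b * (sgn k′ * M zero a * D)
        ≡⟨ exchange-factors (sgn a) (sgn k) (sgn b) (sgn k′) (M zero a) (M (suc zero) b) D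
                            sgn-antisym ⟩
      - (sgn a * M zero a * (sgn k * M (suc zero) b * D))
        ≡⟨ cong (λ x → - (sgn a * M zero a * (sgn k * M (suc zero) x * D))) punchIn-a-k ⟨
      - twoRowTerm M a k
        ≡⟨ cong -_ (columnPairTerm-punchIn M punchIn-a-k) ⟨
      - columnPairTerm M a b                               ∎
      where
      open ColumnPairDeletion (columnPairDeletion a≢b)
      D : ℤ
      D = det n (minor (minor M a) k)

  det-swapFirstRows : ∀ M → det (suc (suc n)) (M ∘ swapAt zero) ≡ - det (suc (suc n)) M
  det-swapFirstRows M = begin
    det (suc (suc n)) (M ∘ swapAt zero)                  ≡⟨ det-columnPairs (M ∘ swapAt zero) ⟩
    ∑∑ (λ a b → columnPairTerm (M ∘ swapAt zero) a b)
      ≡⟨ sumℤ-comm _ _ (columnPairTerm (M ∘ swapAt zero)) ⟩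
    ∑∑ (λ b a → columnPairTerm (M ∘ swapAt zero) a b)
      ≡⟨ sumℤ-cong _ (λ b → sumℤ-cong _ (columnPairTerm-swapRows M b)) ⟩
    ∑∑ (λ b a → - columnPairTerm M b a)
      ≡⟨ sumℤ-cong _ (λ b → neg-distrib-sumℤ _ (columnPairTerm M b)) ⟨
    sumℤ (suc (suc n)) (λ b → - sumℤ (suc (suc n)) (columnPairTerm M b))
      ≡⟨ neg-distrib-sumℤ _ (λ b → sumℤ (suc (suc n)) (columnPairTerm M b)) ⟨
    - ∑∑ (columnPairTerm M)                              ≡⟨ cong -_ (det-columnPairs M) ⟨
    - det (suc (suc n)) M                                ∎
    where
    ∑∑ : (Fin (suc (suc n)) → Fin (suc (suc n)) → ℤ) → ℤ
    ∑∑ f = sumℤ (suc (suc n)) (λ a → sumℤ (suc (suc n)) (f a))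

det-swapRows : ∀ n (c : Fin n) (M : Matrix (suc n)) → det (suc n) (M ∘ swapAt c) ≡ - det (suc n) M
det-swapRows (suc n) zero    M = det-swapFirstRows M
det-swapRows (suc n) (suc c) M = begin
  det (suc (suc n)) (M ∘ swapAt (suc c))
    ≡⟨ sumℤ-cong (suc (suc n)) (λ j → cong (sgn j * M zero j *_) (det-swapRows n c (minor M j))) ⟩
  sumℤ (suc (suc n)) (λ j → sgn j * M zero j * - det (suc n) (minor M j))
    ≡⟨ sumℤ-cong (suc (suc n)) (λ j → neg-*-*ʳ (sgn j) (M zero j) (det (suc n) (minor M j))) ⟩
  sumℤ (suc (suc n)) (λ j → - laplaceTerm M j)  ≡⟨ neg-distrib-sumℤ (suc (suc n)) (laplaceTerm M) ⟨
  - det (suc (suc n)) M                         ∎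

det-reindex-swapAt : ∀ n (c : Fin n) (M : Matrix (suc n)) →
                     det (suc n) (reindex (swapAt c) M) ≡ det (suc n) M
det-reindex-swapAt n c M = begin
  det (suc n) (reindex (swapAt c) M)        ≡⟨ det-swapRows n c (λ r → M r ∘ swapAt c) ⟩
  - det (suc n) (λ r → M r ∘ swapAt c)      ≡⟨ cong -_ (det-swapColumns n c M) ⟩
  - - det (suc n) M                         ≡⟨ neg-involutive _ ⟩
  det (suc n) M                             ∎

data SwapProduct : (n : ℕ) → (Fin n → Fin n) → Set where
  identity   : ∀ {n} → SwapProduct n (λ i → i)
  _·swapAt_  : ∀ {n f} → SwapProduct (suc n) f → (c : Fin n) → SwapProduct (suc n) (f ∘ swapAt c)
  resp-≗     : ∀ {n f g} → f ≗ g → SwapProduct n f → SwapProduct n g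

det-reindex-swapProduct : ∀ {n σ} → SwapProduct n σ → ∀ M → det n (reindex σ M) ≡ det n M
det-reindex-swapProduct identity M = refl
det-reindex-swapProduct {suc n} (_·swapAt_ {f = f} p c) M =
  trans (det-reindex-swapAt n c (reindex f M)) (det-reindex-swapProduct p M)
det-reindex-swapProduct {n} (resp-≗ f≗g p) M =
  trans (det-cong n λ r c → cong₂ M (sym (f≗g r)) (sym (f≗g c))) (det-reindex-swapProduct p M)

swapProduct-∘ : ∀ {n f g} → SwapProduct n f → SwapProduct n g → SwapProduct n (f ∘ g)
swapProduct-∘ p identity           = p
swapProduct-∘ p (q ·swapAt c)      = swapProduct-∘ p q ·swapAt c
swapProduct-∘ {f = f} p (resp-≗ g≗h q) = resp-≗ (cong f ∘ g≗h) (swapProduct-∘ p q)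

swapProduct-lift : ∀ {n f} → SwapProduct n f → SwapProduct (suc n) (Fin.lift 1 f)
swapProduct-lift identity       = resp-≗ (λ { zero → refl ; (suc i) → refl }) identity
swapProduct-lift (p ·swapAt c)  =
  resp-≗ (λ { zero → refl ; (suc i) → refl }) (swapProduct-lift p ·swapAt suc c)
swapProduct-lift (resp-≗ f≗g p) =
  resp-≗ (λ { zero → refl ; (suc i) → cong suc (f≗g i) }) (swapProduct-lift p)

moveZeroTo : ∀ {n} → Fin (suc n) → Fin (suc n) → Fin (suc n)
moveZeroTo k zero    = k
moveZeroTo k (suc i) = punchIn k i

swapProduct-moveZeroTo : ∀ n (k : Fin (suc n)) → SwapProduct (suc n) (moveZeroTo k)
swapProduct-moveZeroTo n       zero    = resp-≗ (λ { zero → refl ; (suc i) → refl }) identity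
swapProduct-moveZeroTo (suc n) (suc k) =
  resp-≗ (λ { zero → refl ; (suc zero) → refl ; (suc (suc i)) → refl })
         (swapProduct-lift (swapProduct-moveZeroTo n k) ·swapAt zero)

swapProduct-injective : ∀ n (σ : Fin n → Fin n) → Injective _≡_ _≡_ σ → SwapProduct n σ
swapProduct-injective zero    σ σ-inj = resp-≗ (λ ()) identity
swapProduct-injective (suc n) σ σ-inj =
  resp-≗ (λ { zero → refl ; (suc i) → punchIn-punchOut (σ₀≢σₛ i) })
         (swapProduct-∘ (swapProduct-moveZeroTo n (σ zero))
                        (swapProduct-lift (swapProduct-injective n σ′ σ′-inj)))
  where
  σ₀≢σₛ : ∀ i → σ zero ≢ σ (suc i)
  σ₀≢σₛ i = 0≢1+n ∘ σ-inj

  σ′ : Fin n → Fin n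
  σ′ i = punchOut (σ₀≢σₛ i)

  σ′-inj : Injective _≡_ _≡_ σ′
  σ′-inj σ′i≡σ′j = suc-injective (σ-inj (punchOut-injective (σ₀≢σₛ _) (σ₀≢σₛ _) σ′i≡σ′j))

det-reindex-↔ : ∀ {p q} (π : Fin p ↔ Fin q) (M : Matrix q) →
                det p (reindex (Inverse.to π) M) ≡ det q M
det-reindex-↔ {p} π M with refl ← ↔⇒≡ π =
  det-reindex-swapProduct (swapProduct-injective p _ (Injection.injective (↔⇒↣ π))) M

isYes-≟-injective : ∀ {p q} {σ : Fin p → Fin q} → Injective _≡_ _≡_ σ →
                    ∀ k l → ⌊ σ k Fin.≟ σ l ⌋ ≡ ⌊ k Fin.≟ l ⌋
isYes-≟-injective {σ = σ} σ-inj k l = begin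
  ⌊ σ k Fin.≟ σ l ⌋     ≡⟨ isYes≗does (σ k Fin.≟ σ l) ⟩
  does (σ k Fin.≟ σ l)  ≡⟨ does-⇔ (mk⇔ σ-inj (cong σ)) (σ k Fin.≟ σ l) (k Fin.≟ l) ⟩
  does (k Fin.≟ l)      ≡⟨ isYes≗does (k Fin.≟ l) ⟨
  ⌊ k Fin.≟ l ⌋         ∎

charMatrix : ∀ {n m} → ClusteredGraph n m → ℤ → Matrix (n ℕ.* m)
charMatrix G t k l = (if ⌊ k Fin.≟ l ⌋ then t else 0ℤ) - adjMatrix G k l

isomorphic⇒charPolyAt≡ : ∀ {n m n′ m′} {G : ClusteredGraph n m} {H : ClusteredGraph n′ m′} →
                         Isomorphic G H → ∀ t → charPolyAt G t ≡ charPolyAt H t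
isomorphic⇒charPolyAt≡ {n} {m} {n′} {m′} {G} {H} (f , f-adj) t = begin
  det (n ℕ.* m) (charMatrix G t)               ≡⟨ det-cong (n ℕ.* m) entries ⟩
  det (n ℕ.* m) (reindex σ (charMatrix H t))   ≡⟨ det-reindex-↔ π (charMatrix H t) ⟩
  det (n′ ℕ.* m′) (charMatrix H t)             ∎
  where
  π : Fin (n ℕ.* m) ↔ Fin (n′ ℕ.* m′)
  π = ↔-sym *↔× ↔-∘ (f ↔-∘ *↔×)

  σ : Fin (n ℕ.* m) → Fin (n′ ℕ.* m′)
  σ = Inverse.to π

  adjacency : ∀ k l → adj G (Fin.remQuot m k) (Fin.remQuot m l) ≡
                      adj H (Fin.remQuot m′ (σ k)) (Fin.remQuot m′ (σ l))
  adjacency k l = begin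
    adj G (Fin.remQuot m k) (Fin.remQuot m l)
      ≡⟨ f-adj (Fin.remQuot m k) (Fin.remQuot m l) ⟨
    adj H (Inverse.to f (Fin.remQuot m k)) (Inverse.to f (Fin.remQuot m l))
      ≡⟨ cong₂ (adj H) (Inverse.strictlyInverseˡ *↔× _) (Inverse.strictlyInverseˡ *↔× _) ⟨
    adj H (Fin.remQuot m′ (σ k)) (Fin.remQuot m′ (σ l))  ∎

  entries : ∀ k l → charMatrix G t k l ≡ charMatrix H t (σ k) (σ l)
  entries k l = cong₂ _-_
    (cong (if_then t else 0ℤ) (sym (isYes-≟-injective (Injection.injective (↔⇒↣ π)) k l)))
    (cong (if_then 1ℤ else 0ℤ) (adjacency k l))

alternating-isomorphic : ∀ {n m} (G : ClusteredGraph n m) → Isomorphic G (alternating G)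
alternating-isomorphic G = ×-comm _ _ , λ u v → refl

partialTranspose-alternating : ∀ {n m} (G : ClusteredGraph n m) →
  Isomorphic (partialTranspose G) (partialTranspose (alternating G))
partialTranspose-alternating G = ×-comm _ _ , τadj-swap
  where
  τadj-swap : ∀ u v → τadj (alternating G) (swap u) (swap v) ≡ τadj G u v
  τadj-swap (i , a) (j , b) with a Fin.≟ b | i Fin.≟ j
  ... | yes refl | yes refl = refl
  ... | yes refl | no _     = refl
  ... | no _     | yes refl = refl
  ... | no _     | no _     = adj-sym G (j , a) (i , b)

theorem10 : (n m : ℕ) (G : ClusteredGraph n m) →
    Isomorphic (partialTranspose G) (partialTranspose (alternating G))
    × (Cospectral G (partialTranspose G) →
       Cospectral (alternating G) (partialTranspose (alternating G)))
theorem10 n m G = partialTranspose-alternating G , λ G-cospectral t → begin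
  charPolyAt (alternating G) t
    ≡⟨ isomorphic⇒charPolyAt≡ {G = G} {alternating G} (alternating-isomorphic G) t ⟨
  charPolyAt G t                                   ≡⟨ G-cospectral t ⟩
  charPolyAt (partialTranspose G) t
    ≡⟨ isomorphic⇒charPolyAt≡ {G = partialTranspose G} {partialTranspose (alternating G)}
                              (partialTranspose-alternating G) t ⟩
  charPolyAt (partialTranspose (alternating G)) t  ∎
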